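{- Let $D$ be a diagram and $D_1,D_2\in\mathcal{P}(D)$. Suppose there exist integers $1\le j<r$ and $c>0$ such that $D_2\prec D_1$ and $D_2=D_1\big\downarrow^{(r,c)}_{(r-j,c)}$. Then $D_2$ is covered by $D_1$ in $\mathcal{P}(D)$ (i.e. there is no $\tilde D\in\mathcal{P}(D)$ with $D_2\prec\tilde D\prec D_1$) if and only if for each $\tilde r$ with $r-j<\tilde r<r$ there exists $\tilde c>c$ with $(\tilde r,\tilde c)\in D_1$.
   Context: A diagram is a finite set of cells in $\mathbb{Z}_{>0}\times\mathbb{Z}_{>0}$; a cell $(r,c)$ lies in row $r$ (rows numbered from the bottom, starting at $1$) and column $c$. Applying a Kohnert move at row $r$ of a diagram $D$: if row $r$ is nonempty, let $(r,c)$ be its rightmost cell; if there is $r'$ with $1\le r'<r$ and $(r',c)\notin D$, take the largest such $r'$ and replace $(r,c)$ by $(r',c)$; otherwise $D$ is unchanged. When a Kohnert move at row $r$ of $D$ moves the cell $(r,c)$ to $(r',c)$, producing $D'$, one writes $D'=D\big\downarrow^{(r,c)}_{(r',c)}$. The Kohnert poset $\mathcal{P}(D)$ is the set of diagrams obtainable from $D$ by finite (possibly empty) sequences of Kohnert moves, with $D_2\preceq D_1$ iff $D_2$ can be obtained from $D_1$ by Kohnert moves. -}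

module Defs where

open import Data.Nat using (ℕ; _≤_; _<_)
open import Data.Product using (_×_; _,_; ∃; ∃-syntax)
open import Data.Sum using (_⊎_)
open import Data.List using (List)
open import Data.List.Relation.Unary.All using (All)
open import Data.List.Membership.Propositional using (_∈_; _∉_)
open import Relation.Binary.PropositionalEquality using (_≡_; _≢_)
open import Relation.Binary.Construct.Closure.ReflexiveTransitive using (Star)
open import Relation.Nullary using (¬_)
open import Function.Bundles using (_⇔_)

-- A cell (r , c): row r (numbered from the bottom, starting at 1), column c.
Cell : Set
Cell = ℕ × ℕ

-- A diagram is a finite set of cells, represented by a finite list of cells
-- (order and repetitions irrelevant; all notions below depend only on membership).
Diagram : Set
Diagram = List Cell

IsDiagram : Diagram → Set
IsDiagram D = All (λ x → 1 ≤ Data.Product.proj₁ x × 1 ≤ Data.Product.proj₂ x) D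

_≈_ : Diagram → Diagram → Set
D ≈ E = ∀ x → (x ∈ D) ⇔ (x ∈ E)

-- D' = D ↓^{(r,c)}_{(r',c)} : the Kohnert move at row r of D moves the
-- cell (r , c) to (r' , c), producing D'.
KohnertMoveTo : Diagram → ℕ → ℕ → ℕ → Diagram → Set
KohnertMoveTo D r c r' D' =
    ((r , c) ∈ D)
  × (∀ c' → c < c' → (r , c') ∉ D)
  -- r' is the largest r' with 1 ≤ r' < r and (r' , c) ∉ D
  × (1 ≤ r') × (r' < r) × ((r' , c) ∉ D)
  × (∀ r'' → r' < r'' → r'' < r → (r'' , c) ∈ D)
  × (∀ x → (x ∈ D') ⇔ ((x ∈ D × x ≢ (r , c)) ⊎ x ≡ (r' , c)))

-- A Kohnert move that changes the diagram (moves that leave D unchanged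
-- contribute nothing beyond reflexivity).
KohnertStep : Diagram → Diagram → Set
KohnertStep D D' = ∃[ r ] ∃[ c ] ∃[ r' ] KohnertMoveTo D r c r' D'

_⪯_ : Diagram → Diagram → Set
D₂ ⪯ D₁ = ∃[ E ] (Star KohnertStep D₁ E × E ≈ D₂)

_≺_ : Diagram → Diagram → Set
D₂ ≺ D₁ = D₂ ⪯ D₁ × ¬ (D₂ ≈ D₁)

_∈𝒫_ : Diagram → Diagram → Set
E ∈𝒫 D = E ⪯ D

CoveredIn : Diagram → Diagram → Diagram → Set
CoveredIn D D₂ D₁ = ¬ (∃[ E ] (E ∈𝒫 D × D₂ ≺ E × E ≺ D₁))

-- A Kohnert move only lowers a cell inside its column, so along any chain of
-- moves a cell that disappears from a column is compensated by a new cell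
-- further down, and a new cell by a vanished one further up.  By infinite
-- descent, a diagram E with D₁ ⪰ E ⪰ D₂ therefore agrees with D₁ and D₂ in
-- every column other than c, and in column c below row r - j and above row r.
-- Strictly between these rows, the cell (r̃ , c) of D₁ has a cell (r̃ , c̃),
-- c̃ > c, to its right, which is present in every diagram from D₁ down to E;
-- so (r̃ , c) is never the rightmost cell of its row and stays in place.
-- Hence E differs from D₁ at most in the cells (r , c) and (r - j , c), and
-- compensation excludes E containing both or neither of them, leaving E ≈ D₁
-- or E ≈ D₂.  Conversely, if some row r̃ strictly between has nothing to the
-- right of (r̃ , c), moving (r̃ , c) down to row r - j and then (r , c) down
-- to row r̃ passes through a diagram strictly between D₁ and D₂.
module Submission where

open import Defs
open import Data.Nat using (ℕ; _≤_; _<_; _∸_; _≟_; _<?_)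
open import Data.Nat.Properties
  using (<-trans; <-cmp; ≤-refl; ≤-trans; <⇒≤; ≤-<-trans; <-≤-trans; <⇒≢; >⇒≢; ∸-monoʳ-<)
open import Data.Nat.Induction using (<-wellFounded)
open import Data.Product using (_×_; _,_; proj₁; proj₂; ∃-syntax)
open import Data.Product.Properties using (≡-dec; ,-injectiveˡ; ,-injectiveʳ)
open import Data.Product.Function.NonDependent.Propositional using (_×-⇔_)
open import Data.Sum using (_⊎_; inj₁; inj₂)
open import Data.Sum.Function.Propositional using (_⊎-⇔_)
open import Data.List using (filter; map; _∷_)
open import Data.List.Extrema.Nat using (max; xs≤max)
open import Data.List.Membership.Propositional using (_∈_; _∉_; find; lose)
open import Data.List.Membership.Propositional.Properties using (∈-filter⁺; ∈-filter⁻; ∈-map⁺)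
open import Data.List.Relation.Unary.All as All using ()
open import Data.List.Relation.Unary.Any using (Any; here; there; any?)
open import Data.Empty using (⊥; ⊥-elim)
open import Function using (_∘_; _on_; const)
open import Function.Bundles using (_⇔_; mk⇔; module Equivalence)
open import Function.Construct.Composition using (_⇔-∘_)
open import Function.Construct.Identity using (⇔-id)
open import Function.Construct.Symmetry using (⇔-sym)
open import Induction.InfiniteDescent using (descent∧wf⇒empty)
open import Level using (0ℓ)
open import Relation.Binary.Construct.Closure.ReflexiveTransitive using (Star; ε; _◅_; _◅◅_)
open import Relation.Binary.Construct.On as On using ()
open import Relation.Binary.Definitions using (DecidableEquality; tri<; tri≈; tri>)
open import Relation.Binary.PropositionalEquality using (_≡_; _≢_; refl; sym; subst)
open import Relation.Nullary using (¬_; Dec; yes; no)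
open import Relation.Nullary.Decidable using (map′; decidable-stable; ¬?; _×-dec_)
open import Relation.Unary using (Pred; Empty)

open Equivalence using (to; from)

_≟ᶜ_ : DecidableEquality Cell
_≟ᶜ_ = ≡-dec _≟_ _≟_

open import Data.List.Membership.DecPropositional _≟ᶜ_ using (_∈?_)

row-≢ : ∀ {a b k l : ℕ} → a ≢ b → (a , k) ≢ (b , l)
row-≢ a≢b = a≢b ∘ ,-injectiveˡ

column-≢ : ∀ {a b k l : ℕ} → k ≢ l → (a , k) ≢ (b , l)
column-≢ k≢l = k≢l ∘ ,-injectiveʳ

no-difference⇒∈⇔∈ : ∀ {x : Cell} {X Y} →
  ¬ (x ∈ X × x ∉ Y) → ¬ (x ∈ Y × x ∉ X) → x ∈ X ⇔ x ∈ Y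
no-difference⇒∈⇔∈ {x} {X} {Y} X∖Y Y∖X = mk⇔
  (λ x∈X → decidable-stable (x ∈? Y) (λ x∉Y → X∖Y (x∈X , x∉Y)))
  (λ x∈Y → decidable-stable (x ∈? X) (λ x∉X → Y∖X (x∈Y , x∉X)))

≈-refl : ∀ {X} → X ≈ X
≈-refl x = ⇔-id _

≈-sym : ∀ {X Y} → X ≈ Y → Y ≈ X
≈-sym X≈Y x = ⇔-sym (X≈Y x)

≈-trans : ∀ {X Y Z} → X ≈ Y → Y ≈ Z → X ≈ Z
≈-trans X≈Y Y≈Z x = Y≈Z x ⇔-∘ X≈Y x

≈-from-two-cells : ∀ {X Y} (z z' : Cell) →
  (∀ x → x ≢ z → x ≢ z' → x ∈ X ⇔ x ∈ Y) →
  z ∈ X ⇔ z ∈ Y → z' ∈ X ⇔ z' ∈ Y → X ≈ Y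
≈-from-two-cells z z' elsewhere at-z at-z' x with x ≟ᶜ z | x ≟ᶜ z'
... | yes refl | _        = at-z
... | no _     | yes refl = at-z'
... | no x≢z   | no x≢z'  = elsewhere x x≢z x≢z'

module KohnertMove {X X' : Diagram} {s q t : ℕ} (move : KohnertMoveTo X s q t X') where

  source∈ : (s , q) ∈ X
  source∈ = let (p , _) = move in p

  source-rightmost : ∀ c' → q < c' → (s , c') ∉ X
  source-rightmost = let (_ , p , _) = move in p

  1≤target : 1 ≤ t
  1≤target = let (_ , _ , p , _) = move in p

  target<source : t < s
  target<source = let (_ , _ , _ , p , _) = move in p

  target∉ : (t , q) ∉ X
  target∉ = let (_ , _ , _ , _ , p , _) = move in p

  between∈ : ∀ r → t < r → r < s → (r , q) ∈ X
  between∈ = let (_ , _ , _ , _ , _ , p , _) = move in p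

  ∈-result : ∀ x → x ∈ X' ⇔ ((x ∈ X × x ≢ (s , q)) ⊎ x ≡ (t , q))
  ∈-result = let (_ , _ , _ , _ , _ , _ , p) = move in p

  ∈-after : ∀ {x} → x ∈ X → x ≢ (s , q) → x ∈ X'
  ∈-after x∈X x≢s = from (∈-result _) (inj₁ (x∈X , x≢s))

  ∈-before : ∀ {x} → x ∈ X' → x ≢ (t , q) → x ∈ X
  ∈-before x∈X' x≢t with to (∈-result _) x∈X'
  ... | inj₁ (x∈X , _) = x∈X
  ... | inj₂ x≡t        = ⊥-elim (x≢t x≡t)

  target∈after : (t , q) ∈ X'
  target∈after = from (∈-result _) (inj₂ refl)

  source∉after : (s , q) ∉ X'
  source∉after s∈X' with to (∈-result _) s∈X'
  ... | inj₁ (_ , s≢s) = s≢s refl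
  ... | inj₂ s≡t        = >⇒≢ target<source (,-injectiveˡ s≡t)

  unmoved : ∀ {x} → x ≢ (s , q) → x ≢ (t , q) → x ∈ X ⇔ x ∈ X'
  unmoved x≢s x≢t = mk⇔ (λ x∈X → ∈-after x∈X x≢s) (λ x∈X' → ∈-before x∈X' x≢t)

open KohnertMove

move-respects-≈ : ∀ {X X' Y s q t} → X ≈ X' → KohnertMoveTo X s q t Y → KohnertMoveTo X' s q t Y
move-respects-≈ X≈X' move =
  to (X≈X' _) (source∈ move) ,
  (λ c' q<c' → source-rightmost move c' q<c' ∘ from (X≈X' _)) ,
  1≤target move , target<source move ,
  target∉ move ∘ from (X≈X' _) ,
  (λ r t<r r<s → to (X≈X' _) (between∈ move r t<r r<s)) ,
  λ x → ((X≈X' x ×-⇔ ⇔-id _) ⊎-⇔ ⇔-id _) ⇔-∘ ∈-result move x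

_⟶*_ : Diagram → Diagram → Set
_⟶*_ = Star KohnertStep

⟶*-respects-≈ : ∀ {X X' Y} → X ≈ X' → X ⟶* Y → ∃[ Y' ] (X' ⟶* Y' × Y' ≈ Y)
⟶*-respects-≈ {X' = X'} X≈X' ε = X' , ε , ≈-sym X≈X'
⟶*-respects-≈ {Y = Y} X≈X' ((s , q , t , move) ◅ P) =
  Y , (s , q , t , move-respects-≈ X≈X' move) ◅ P , ≈-refl

moveCell : Cell → Cell → Diagram → Diagram
moveCell z z' X = z' ∷ filter (λ y → ¬? (y ≟ᶜ z)) X

∈-moveCell : ∀ {z z' X} x → x ∈ moveCell z z' X ⇔ ((x ∈ X × x ≢ z) ⊎ x ≡ z')
∈-moveCell {z} x = mk⇔
  (λ { (here x≡z') → inj₂ x≡z'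
     ; (there x∈)   → inj₁ (∈-filter⁻ (λ y → ¬? (y ≟ᶜ z)) x∈) })
  (λ { (inj₁ (x∈X , x≢z)) → there (∈-filter⁺ (λ y → ¬? (y ≟ᶜ z)) x∈X x≢z)
     ; (inj₂ x≡z')        → here x≡z' })

moveCell-isKohnertMove : ∀ {X s q t} → (s , q) ∈ X → (∀ c' → q < c' → (s , c') ∉ X) →
  1 ≤ t → t < s → (t , q) ∉ X → (∀ r → t < r → r < s → (r , q) ∈ X) →
  KohnertMoveTo X s q t (moveCell (s , q) (t , q) X)
moveCell-isKohnertMove s∈ rightmost 1≤t t<s t∉ between =
  s∈ , rightmost , 1≤t , t<s , t∉ , between , ∈-moveCell

CellRightOf : Diagram → ℕ → ℕ → Set
CellRightOf X s c = ∃[ c' ] (c < c' × (s , c') ∈ X)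

cellRightOf? : ∀ X s c → Dec (CellRightOf X s c)
cellRightOf? X s c = map′ witness (λ (c' , c<c' , x∈X) → lose x∈X (refl , c<c')) (any? right-of-c? X)
  where
  right-of-c? : ∀ (x : Cell) → Dec (proj₁ x ≡ s × c < proj₂ x)
  right-of-c? (s' , c') = (s' ≟ s) ×-dec (c <? c')
  witness : Any (λ x → proj₁ x ≡ s × c < proj₂ x) X → CellRightOf X s c
  witness found with find found
  ... | (_ , c') , x∈X , refl , c<c' = c' , c<c' , x∈X

descent⇒empty : ∀ {ℓ} {P : Pred ℕ ℓ} → (∀ {a} → P a → ∃[ b ] (b < a × P b)) → Empty P
descent⇒empty descent = descent∧wf⇒empty descent <-wellFounded

bounded-ascent⇒empty : ∀ {ℓ} {P : Pred ℕ ℓ} M → (∀ {a} → P a → a ≤ M) →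
  (∀ {a} → P a → ∃[ b ] (a < b × P b)) → Empty P
bounded-ascent⇒empty {P = P} M bounded ascent =
  descent∧wf⇒empty {_<_ = _<_ on (M ∸_)} step (On.wellFounded (M ∸_) <-wellFounded)
  where
  step : ∀ {a} → P a → ∃[ b ] ((M ∸ b) < (M ∸ a) × P b)
  step Pa = let (b , a<b , Pb) = ascent Pa in b , ∸-monoʳ-< a<b (bounded Pb) , Pb

rows-bounded : ∀ X → ∃[ M ] (∀ {a k} → (a , k) ∈ X → a ≤ M)
rows-bounded X = max 0 (map row X) , λ a∈X → All.lookup (xs≤max 0 (map row X)) (∈-map⁺ row a∈X)
  where
  row : Cell → ℕ
  row = proj₁

LossesCompensatedBelow : Diagram → Diagram → Set
LossesCompensatedBelow X Y =
  ∀ {b k} → (b , k) ∈ X → (b , k) ∉ Y → ∃[ a ] (a < b × (a , k) ∈ Y × (a , k) ∉ X)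

GainsCompensatedAbove : Diagram → Diagram → Set
GainsCompensatedAbove X Y =
  ∀ {a k} → (a , k) ∈ Y → (a , k) ∉ X → ∃[ b ] (a < b × (b , k) ∈ X × (b , k) ∉ Y)

module _ {X X' Y : Diagram} {s q t : ℕ} (move : KohnertMoveTo X s q t X') where

  gained-below-target : LossesCompensatedBelow X' Y →
    ∀ {b} → t < b → ∃[ a ] (a < b × (a , q) ∈ Y × (a , q) ∉ X)
  gained-below-target compensated t<b with (t , q) ∈? Y
  ... | yes t∈Y = t , t<b , t∈Y , target∉ move
  ... | no t∉Y =
    let (a , a<t , a∈Y , a∉X') = compensated (target∈after move) t∉Y
    in a , <-trans a<t t<b , a∈Y ,
       λ a∈X → a∉X' (∈-after move a∈X (row-≢ (<⇒≢ (<-trans a<t (target<source move)))))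

  lost-above-source : GainsCompensatedAbove X' Y →
    ∀ {a} → a < s → ∃[ b ] (a < b × (b , q) ∈ X × (b , q) ∉ Y)
  lost-above-source compensated a<s with (s , q) ∈? Y
  ... | no s∉Y = s , a<s , source∈ move , s∉Y
  ... | yes s∈Y =
    let (b , s<b , b∈X' , b∉Y) = compensated s∈Y (source∉after move)
    in b , <-trans a<s s<b ,
       ∈-before move b∈X' (row-≢ (>⇒≢ (<-trans (target<source move) s<b))) , b∉Y

losses-compensated-below : ∀ {X Y} → X ⟶* Y → LossesCompensatedBelow X Y
losses-compensated-below ε b∈X b∉Y = ⊥-elim (b∉Y b∈X)
losses-compensated-below ((s , q , t , move) ◅ P) {b} {k} b∈X b∉Y with (b , k) ≟ᶜ (s , q)
... | yes refl = gained-below-target move (losses-compensated-below P) (target<source move)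
... | no b≢s with losses-compensated-below P (∈-after move b∈X b≢s) b∉Y
...   | a , a<b , a∈Y , a∉X' with (a , k) ≟ᶜ (s , q)
...     | yes refl = gained-below-target move (losses-compensated-below P) (<-trans (target<source move) a<b)
...     | no a≢s   = a , a<b , a∈Y , λ a∈X → a∉X' (∈-after move a∈X a≢s)

gains-compensated-above : ∀ {X Y} → X ⟶* Y → GainsCompensatedAbove X Y
gains-compensated-above ε a∈Y a∉X = ⊥-elim (a∉X a∈Y)
gains-compensated-above ((s , q , t , move) ◅ P) {a} {k} a∈Y a∉X with (a , k) ≟ᶜ (t , q)
... | yes refl = lost-above-source move (gains-compensated-above P) (target<source move)
... | no a≢t with gains-compensated-above P a∈Y (λ a∈X' → a∉X (∈-before move a∈X' a≢t))
...   | b , a<b , b∈X' , b∉Y with (b , k) ≟ᶜ (t , q)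
...     | yes refl = lost-above-source move (gains-compensated-above P) (<-trans a<b (target<source move))
...     | no b≢t   = b , a<b , ∈-before move b∈X' b≢t , b∉Y

ColumnAgree : ℕ → Pred ℕ 0ℓ → Diagram → Diagram → Set
ColumnAgree k R X Y = ∀ {a} → R a → (a , k) ∈ X ⇔ (a , k) ∈ Y

module _ {A X B : Diagram} {k : ℕ} (A⟶*X : A ⟶* X) (X⟶*B : X ⟶* B) where

  agree-below-between : ∀ {t} → ColumnAgree k (_≤ t) A B → ColumnAgree k (_≤ t) X A
  agree-below-between {t} A≈B {a} a≤t = no-difference⇒∈⇔∈
    (λ (a∈X , a∉A) → X∖A-empty a (a≤t , a∈X , a∉A))
    (λ (a∈A , a∉X) →
      let (a' , a'<a , a'∈X , a'∉A) = losses-compensated-below A⟶*X a∈A a∉X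
      in X∖A-empty a' (≤-trans (<⇒≤ a'<a) a≤t , a'∈X , a'∉A))
    where
    X∖A-empty : Empty (λ a → a ≤ t × (a , k) ∈ X × (a , k) ∉ A)
    X∖A-empty = descent⇒empty λ (a≤t , a∈X , a∉A) →
      let (a' , a'<a , a'∈B , a'∉X) = losses-compensated-below X⟶*B a∈X (a∉A ∘ from (A≈B a≤t))
          a'≤t = ≤-trans (<⇒≤ a'<a) a≤t
          (a'' , a''<a' , a''∈X , a''∉A) = losses-compensated-below A⟶*X (from (A≈B a'≤t) a'∈B) a'∉X
      in a'' , <-trans a''<a' a'<a , ≤-trans (<⇒≤ a''<a') a'≤t , a''∈X , a''∉A

  agree-above-between : ∀ {t} → ColumnAgree k (t ≤_) A B → ColumnAgree k (t ≤_) X A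
  agree-above-between {t} A≈B {a} t≤a = no-difference⇒∈⇔∈
    (λ (a∈X , a∉A) → X∖A-empty a (t≤a , a∈X , a∉A))
    (λ (a∈A , a∉X) →
      let (b , a<b , b∈X , b∉B) = gains-compensated-above X⟶*B (to (A≈B t≤a) a∈A) a∉X
          t≤b = ≤-trans t≤a (<⇒≤ a<b)
      in X∖A-empty b (t≤b , b∈X , b∉B ∘ to (A≈B t≤b)))
    where
    X∖A-empty : Empty (λ a → t ≤ a × (a , k) ∈ X × (a , k) ∉ A)
    X∖A-empty = let (M , X≤M) = rows-bounded X in
      bounded-ascent⇒empty M (λ (_ , a∈X , _) → X≤M a∈X) λ (t≤a , a∈X , a∉A) →
      let (b , a<b , b∈A , b∉X) = gains-compensated-above A⟶*X a∈X a∉A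
          t≤b = ≤-trans t≤a (<⇒≤ a<b)
          (b' , b<b' , b'∈X , b'∉B) = gains-compensated-above X⟶*B (to (A≈B t≤b) b∈A) b∉X
          t≤b' = ≤-trans t≤b (<⇒≤ b<b')
      in b' , <-trans a<b b<b' , t≤b' , b'∈X , b'∉B ∘ to (A≈B t≤b')

blocked-cell-stays : ∀ {X Y s c} → X ⟶* Y →
  (∀ {Z} → X ⟶* Z → Z ⟶* Y → CellRightOf Z s c) →
  (s , c) ∈ X → (s , c) ∈ Y
blocked-cell-stays ε _ s∈X = s∈X
blocked-cell-stays {s = s} {c} (step@(s' , q , t , move) ◅ P) blocked s∈X with (s , c) ≟ᶜ (s' , q)
... | yes refl = let (c' , c<c' , c'∈X) = blocked ε (step ◅ P) in
  ⊥-elim (source-rightmost move c' c<c' c'∈X)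
... | no s≢s' =
  blocked-cell-stays P (λ X'⟶*Z Z⟶*Y → blocked (step ◅ X'⟶*Z) Z⟶*Y) (∈-after move s∈X s≢s')

module _ {D₁ D₂ E E' : Diagram} {r c r' : ℕ} (move : KohnertMoveTo D₁ r c r' D₂)
  (blocked : ∀ r~ → r' < r~ → r~ < r → ∃[ c~ ] (c < c~ × (r~ , c~) ∈ D₁))
  (D₁⟶*E : D₁ ⟶* E) (E⟶*E' : E ⟶* E') (E'≈D₂ : E' ≈ D₂) where

  private
    D₁⇔E'-elsewhere : ∀ {x} → x ≢ (r , c) → x ≢ (r' , c) → x ∈ D₁ ⇔ x ∈ E'
    D₁⇔E'-elsewhere x≢r x≢r' = ⇔-sym (E'≈D₂ _) ⇔-∘ unmoved move x≢r x≢r'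

    other-column : ∀ {a k} → k ≢ c → (a , k) ∈ D₁ ⇔ (a , k) ∈ E'
    other-column k≢c = D₁⇔E'-elsewhere (column-≢ k≢c) (column-≢ k≢c)

  intermediate-agrees-elsewhere : ∀ {a k} → (a , k) ≢ (r , c) → (a , k) ≢ (r' , c) →
    (a , k) ∈ E ⇔ (a , k) ∈ D₁
  intermediate-agrees-elsewhere {a} {k} a≢r a≢r' with k ≟ c
  ... | no k≢c = agree-below-between D₁⟶*E E⟶*E' (λ _ → other-column k≢c) ≤-refl
  ... | yes refl with <-cmp a r'
  ...   | tri< a<r' _ _ = agree-below-between D₁⟶*E E⟶*E'
          (λ a'≤a → let a'<r' = ≤-<-trans a'≤a a<r' in
            D₁⇔E'-elsewhere (row-≢ (<⇒≢ (<-trans a'<r' (target<source move)))) (row-≢ (<⇒≢ a'<r')))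
          ≤-refl
  ...   | tri≈ _ refl _ = ⊥-elim (a≢r' refl)
  ...   | tri> _ _ r'<a with <-cmp a r
  ...     | tri≈ _ refl _ = ⊥-elim (a≢r refl)
  ...     | tri> _ _ r<a = agree-above-between D₁⟶*E E⟶*E'
            (λ a≤a' → let r<a' = <-≤-trans r<a a≤a' in
              D₁⇔E'-elsewhere (row-≢ (>⇒≢ r<a')) (row-≢ (>⇒≢ (<-trans (target<source move) r<a'))))
            ≤-refl
  ...     | tri< a<r _ _ = mk⇔ (const a∈D₁) (const (blocked-cell-stays D₁⟶*E right-neighbour a∈D₁))
    where
    a∈D₁ : (a , c) ∈ D₁
    a∈D₁ = between∈ move a r'<a a<r
    right-neighbour : ∀ {Z} → D₁ ⟶* Z → Z ⟶* E → CellRightOf Z a c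
    right-neighbour D₁⟶*Z Z⟶*E =
      let (c~ , c<c~ , c~∈D₁) = blocked a r'<a a<r in
      c~ , c<c~ ,
      from (agree-below-between D₁⟶*Z (Z⟶*E ◅◅ E⟶*E') (λ _ → other-column (>⇒≢ c<c~)) ≤-refl)
           c~∈D₁

  intermediate-is-endpoint : E ≈ D₁ ⊎ E ≈ D₂
  intermediate-is-endpoint with (r , c) ∈? E | (r' , c) ∈? E
  ... | yes r∈E | no r'∉E = inj₁ (≈-from-two-cells (r , c) (r' , c)
          (λ _ → intermediate-agrees-elsewhere)
          (mk⇔ (const (source∈ move)) (const r∈E))
          (mk⇔ (⊥-elim ∘ r'∉E) (⊥-elim ∘ target∉ move)))
  ... | no r∉E | yes r'∈E = inj₂ (≈-from-two-cells (r , c) (r' , c)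
          (λ _ x≢r x≢r' → unmoved move x≢r x≢r' ⇔-∘ intermediate-agrees-elsewhere x≢r x≢r')
          (mk⇔ (⊥-elim ∘ r∉E) (⊥-elim ∘ source∉after move))
          (mk⇔ (const (target∈after move)) (const r'∈E)))
  ... | yes r∈E | yes r'∈E =
    let (b , r'<b , b∈D₁ , b∉E) = gains-compensated-above D₁⟶*E r'∈E (target∉ move)
        b≢r = λ b≡r → b∉E (subst (_∈ E) (sym b≡r) r∈E)
    in ⊥-elim (b∉E (from (intermediate-agrees-elsewhere b≢r (row-≢ (>⇒≢ r'<b))) b∈D₁))
  ... | no r∉E | no r'∉E =
    let (a , a<r , a∈E , a∉D₁) = losses-compensated-below D₁⟶*E (source∈ move) r∉E
        a≢r' = λ a≡r' → r'∉E (subst (_∈ E) a≡r' a∈E)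
    in ⊥-elim (a∉D₁ (to (intermediate-agrees-elsewhere (row-≢ (<⇒≢ a<r)) a≢r') a∈E))

no-diagram-strictly-between : ∀ {D₁ D₂ r c r'} → KohnertMoveTo D₁ r c r' D₂ →
  (∀ r~ → r' < r~ → r~ < r → CellRightOf D₁ r~ c) →
  ∀ {E} → D₂ ≺ E → E ≺ D₁ → ⊥
no-diagram-strictly-between move blocked
  ((E' , E⟶*E' , E'≈D₂) , D₂≉E) ((E₀ , D₁⟶*E₀ , E₀≈E) , E≉D₁)
  with ⟶*-respects-≈ (≈-sym E₀≈E) E⟶*E'
... | E₁ , E₀⟶*E₁ , E₁≈E'
  with intermediate-is-endpoint move blocked D₁⟶*E₀ E₀⟶*E₁ (≈-trans E₁≈E' E'≈D₂)
...   | inj₁ E₀≈D₁ = E≉D₁ (≈-trans (≈-sym E₀≈E) E₀≈D₁)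
...   | inj₂ E₀≈D₂ = D₂≉E (≈-trans (≈-sym E₀≈D₂) E₀≈E)

module _ {D D₁ D₂ : Diagram} {r c r' r~ : ℕ}
  (move : KohnertMoveTo D₁ r c r' D₂) (D₁∈𝒫D : D₁ ∈𝒫 D)
  (r'<r~ : r' < r~) (r~<r : r~ < r) (nothing-right : ¬ CellRightOf D₁ r~ c) where

  private
    Ẽ : Diagram
    Ẽ = moveCell (r~ , c) (r' , c) D₁

    E₂ : Diagram
    E₂ = moveCell (r , c) (r~ , c) Ẽ

    r~∈D₁ : (r~ , c) ∈ D₁
    r~∈D₁ = between∈ move r~ r'<r~ r~<r

    first-move : KohnertMoveTo D₁ r~ c r' Ẽ
    first-move = moveCell-isKohnertMove r~∈D₁
      (λ c~ c<c~ c~∈D₁ → nothing-right (c~ , c<c~ , c~∈D₁))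
      (1≤target move) r'<r~ (target∉ move)
      (λ r'' r'<r'' r''<r~ → between∈ move r'' r'<r'' (<-trans r''<r~ r~<r))

    r∈Ẽ : (r , c) ∈ Ẽ
    r∈Ẽ = ∈-after first-move (source∈ move) (row-≢ (>⇒≢ r~<r))

    second-move : KohnertMoveTo Ẽ r c r~ E₂
    second-move = moveCell-isKohnertMove r∈Ẽ rightmost (≤-trans (1≤target move) (<⇒≤ r'<r~)) r~<r
      (source∉after first-move)
      (λ r'' r~<r'' r''<r → ∈-after first-move (between∈ move r'' (<-trans r'<r~ r~<r'') r''<r)
                                                (row-≢ (>⇒≢ r~<r'')))
      where
      rightmost : ∀ c' → c < c' → (r , c') ∉ Ẽ
      rightmost c' c<c' c'∈Ẽ = source-rightmost move c' c<c'
        (∈-before first-move c'∈Ẽ (row-≢ (>⇒≢ (<-trans r'<r~ r~<r))))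

    E₂⇔D₁-elsewhere : ∀ {x} → x ≢ (r , c) → x ≢ (r' , c) → x ∈ E₂ ⇔ x ∈ D₁
    E₂⇔D₁-elsewhere {x} x≢r x≢r' with x ≟ᶜ (r~ , c)
    ... | yes refl = mk⇔ (const r~∈D₁) (const (target∈after second-move))
    ... | no x≢r~ = mk⇔
      (λ x∈E₂ → ∈-before first-move (∈-before second-move x∈E₂ x≢r~) x≢r')
      (λ x∈D₁ → ∈-after second-move (∈-after first-move x∈D₁ x≢r~) x≢r)

    E₂≈D₂ : E₂ ≈ D₂
    E₂≈D₂ = ≈-from-two-cells (r , c) (r' , c)
      (λ _ x≢r x≢r' → unmoved move x≢r x≢r' ⇔-∘ E₂⇔D₁-elsewhere x≢r x≢r')
      (mk⇔ (⊥-elim ∘ source∉after second-move) (⊥-elim ∘ source∉after move))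
      (mk⇔ (const (target∈after move))
           (const (∈-after second-move (target∈after first-move) (row-≢ (<⇒≢ (<-trans r'<r~ r~<r))))))

    Ẽ∈𝒫D : Ẽ ∈𝒫 D
    Ẽ∈𝒫D = let (E , D⟶*E , E≈D₁) = D₁∈𝒫D in
      Ẽ , D⟶*E ◅◅ (r~ , c , r' , move-respects-≈ (≈-sym E≈D₁) first-move) ◅ ε , ≈-refl

  diagram-strictly-between : ∃[ E ] (E ∈𝒫 D × D₂ ≺ E × E ≺ D₁)
  diagram-strictly-between = Ẽ , Ẽ∈𝒫D ,
    ((E₂ , (r , c , r~ , second-move) ◅ ε , E₂≈D₂) ,
      λ D₂≈Ẽ → source∉after move (from (D₂≈Ẽ _) r∈Ẽ)) ,
    ((Ẽ , (r~ , c , r' , first-move) ◅ ε , ≈-refl) ,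
      λ Ẽ≈D₁ → target∉ move (to (Ẽ≈D₁ _) (target∈after first-move)))

corollary3p5 : (D D₁ D₂ : Diagram) → IsDiagram D → D₁ ∈𝒫 D → D₂ ∈𝒫 D →
    (j r c : ℕ) → 1 ≤ j → j < r → 0 < c →
    D₂ ≺ D₁ → KohnertMoveTo D₁ r c (r ∸ j) D₂ →
    CoveredIn D D₂ D₁ ⇔
      (∀ r~ → r ∸ j < r~ → r~ < r → ∃[ c~ ] (c < c~ × (r~ , c~) ∈ D₁))
corollary3p5 D D₁ D₂ _ D₁∈𝒫D _ j r c _ _ _ _ move = mk⇔
  (λ covered r~ r-j<r~ r~<r → decidable-stable (cellRightOf? D₁ r~ c)
    (covered ∘ diagram-strictly-between move D₁∈𝒫D r-j<r~ r~<r))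
  (λ blocked (_ , _ , D₂≺E , E≺D₁) → no-diagram-strictly-between move blocked D₂≺E E≺D₁)
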